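{- Let $G$ be a finite group. Then $\omega(\mathcal{P}_R(G))=\max\{\Omega(m): m\in\pi_e(G)\}+1$.
   Context: The reduced power graph $\mathcal{P}_R(G)$ has vertex set $G$, two distinct vertices $x,y$ adjacent iff $\langle x\rangle\subsetneq\langle y\rangle$ or $\langle y\rangle\subsetneq\langle x\rangle$. $\omega$ denotes the clique number. $\pi_e(G)$ is the set of element orders of $G$; $\Omega(m)$ is the number of prime factors of $m$ counted with multiplicity. -}

module Defs where

open import Level using (Level; _⊔_)
open import Algebra.Bundles using (Group)
open import Data.Nat using (ℕ; zero; suc; _<_)
open import Data.Integer using (ℤ; +_; -[1+_])
open import Data.Fin using (Fin)
open import Data.List using (List; length)
open import Data.List.Relation.Unary.AllPairs using (AllPairs)
open import Data.Nat.Primality.Factorisation using (PrimeFactorisation; factors)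
open import Data.Product using (Σ; ∃; _×_)
open import Function.Bundles using (Inverse)
open import Relation.Nullary using (¬_)
open import Relation.Binary.PropositionalEquality using (_≡_)
import Relation.Binary.PropositionalEquality as ≡

HasΩ : ℕ → ℕ → Set
HasΩ m k = Σ (PrimeFactorisation m) λ f → length (factors f) ≡ k

IsMax : ∀ {p} → (ℕ → Set p) → ℕ → Set p
IsMax P n = P n × (∀ m → P m → m Data.Nat.≤ n)

module _ {c ℓ : Level} (G : Group c ℓ) where
  open Group G

  IsFinite : Set (c ⊔ ℓ)
  IsFinite = ∃ λ n → Inverse (≡.setoid (Fin n)) setoid

  _^ℕ_ : Carrier → ℕ → Carrier
  x ^ℕ zero = ε
  x ^ℕ suc k = x ∙ (x ^ℕ k)

  _^_ : Carrier → ℤ → Carrier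
  x ^ (+ k) = x ^ℕ k
  x ^ -[1+ k ] = (x ^ℕ suc k) ⁻¹

  _∈⟨_⟩ : Carrier → Carrier → Set ℓ
  z ∈⟨ y ⟩ = ∃ λ (k : ℤ) → (y ^ k) ≈ z

  _⊆⟨⟩_ : Carrier → Carrier → Set (c ⊔ ℓ)
  x ⊆⟨⟩ y = ∀ z → z ∈⟨ x ⟩ → z ∈⟨ y ⟩

  _⊊⟨⟩_ : Carrier → Carrier → Set (c ⊔ ℓ)
  x ⊊⟨⟩ y = x ⊆⟨⟩ y × ¬ (y ⊆⟨⟩ x)

  -- adjacency in the reduced power graph P_R(G) (distinct vertices)
  Adj : Carrier → Carrier → Set (c ⊔ ℓ)
  Adj x y = ¬ (x ≈ y) × ((x ⊊⟨⟩ y) Data.Sum.⊎ (y ⊊⟨⟩ x))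
    where import Data.Sum

  IsClique : List Carrier → Set (c ⊔ ℓ)
  IsClique = AllPairs Adj

  CliqueSize : ℕ → Set (c ⊔ ℓ)
  CliqueSize k = Σ (List Carrier) λ xs → IsClique xs × length xs ≡ k

  HasOrder : Carrier → ℕ → Set ℓ
  HasOrder x n = (0 < n) × ((x ^ℕ n) ≈ ε) × (∀ k → 0 < k → k < n → ¬ ((x ^ℕ k) ≈ ε))

  ΩOfElementOrder : ℕ → Set (c ⊔ ℓ)
  ΩOfElementOrder k = Σ Carrier λ x → Σ ℕ λ m → HasOrder x m × HasΩ m k

  CliqueNumber : ℕ → Set (c ⊔ ℓ)
  CliqueNumber w = IsMax CliqueSize w

{-# OPTIONS --safe #-}
-- Label each element by Ω of its order.  If ⟨x⟩ ⊊ ⟨y⟩ then ord x is a proper divisor of ord y: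
-- equal orders would make x = y^j with j coprime to ord y, and then y ∈ ⟨x⟩ by Bézout.  So Ω(ord x)
-- < Ω(ord y), the labels along a clique are pairwise distinct numbers in {0, …, M}, and a clique has at
-- most M + 1 vertices.  Conversely, if x has order p₁⋯p_M (primes), the powers x^(p₁⋯pᵢ), i = 0, …, M,
-- generate a strictly decreasing chain of cyclic subgroups, which is a clique with M + 1 vertices.
module Submission where

open import Defs hiding (_^_)
open import Level using (Level)
open import Algebra.Bundles using (Group)
open import Data.Nat.Base
  using (ℕ; zero; suc; _+_; _*_; _∸_; _≤_; _<_; z≤n; s≤s; NonZero; >-nonZero; nonTrivial⇒n>1)
open import Data.Nat.Properties hiding (^-identityʳ; ^-*-assoc)
open import Data.Nat.Divisibility
open import Data.Nat.DivMod using (_%_; _/_; m≡m%n+[m/n]*n; m%n<n)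
open import Data.Nat.Coprimality using (Coprime; coprime-Bézout)
open import Data.Nat.GCD using (module Bézout)
open import Data.Nat.ListAction using (product)
open import Data.Nat.ListAction.Properties using (product-++)
open import Data.Nat.Primality using (Prime; prime⇒nonTrivial)
open import Data.Nat.Primality.Factorisation
open PrimeFactorisation using (isFactorisation; factorsPrime)
open import Data.Integer using (+_; -[1+_])
open import Data.Fin as Fin using (Fin; zero; suc; toℕ; fromℕ<)
open import Data.Fin.Properties using (injective⇒≤; pigeonhole; fromℕ<-injective)
open import Data.List using (List; []; _∷_; length; map; _++_; lookup; allFin)
open import Data.List.Properties using (length-++; length-map)
open import Data.List.Scans.Base using (scanl)
open import Data.List.Extrema.Nat using (argmax; f[xs]≤f[argmax])
open import Data.List.Membership.Propositional.Properties using (∈-lookup; ∈-map⁺; ∈-allFin)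
open import Data.List.Relation.Binary.Permutation.Propositional.Properties using (↭-length)
open import Data.List.Relation.Unary.All as All using (All; []; _∷_)
import Data.List.Relation.Unary.All.Properties as All
open import Data.List.Relation.Unary.AllPairs as AllPairs using (AllPairs; []; _∷_)
open import Data.Product using (Σ; ∃; _×_; _,_; proj₁; proj₂)
open import Data.Sum using (_⊎_; inj₁; inj₂)
open import Function using (_on_; _∘_; case_of_)
open import Function.Bundles using (Inverse; Injection)
open import Function.Properties.Inverse using (Inverse⇒Injection)
import Function.Construct.Symmetry as Symmetry
open import Relation.Binary using (Decidable)
open import Relation.Binary.PropositionalEquality as ≡ using (_≡_; _≢_)
open import Relation.Nullary using (¬_; contradiction; yes; no)
open import Relation.Nullary.Decidable using (via-injection)
import Relation.Unary as U

module _ {p} {Q : ℕ → Set p} (Q? : U.Decidable Q) where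

  Least : ℕ → Set p
  Least k = Q k × (∀ j → j < k → ¬ Q j)

  least-below : ∀ n → (∀ j → j < n → ¬ Q j) ⊎ ∃ Least
  least-below zero = inj₁ λ _ ()
  least-below (suc n) with least-below n
  ... | inj₂ least = inj₂ least
  ... | inj₁ none-below-n with Q? n
  ...   | yes Qn = inj₂ (n , Qn , none-below-n)
  ...   | no ¬Qn = inj₁ λ j j<1+n → case m<1+n⇒m<n∨m≡n j<1+n of λ where
              (inj₁ j<n)    → none-below-n j j<n
              (inj₂ ≡.refl) → ¬Qn

  least-witness : ∀ {n} → Q n → ∃ Least
  least-witness {n} Qn with least-below (suc n)
  ... | inj₁ none = contradiction Qn (none n (n<1+n n))
  ... | inj₂ least = least

AllPairs-≢-on⇒length≤ : ∀ {a} {A : Set a} {n} (h : A → Fin n) {xs : List A} →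
                        AllPairs (_≢_ on h) xs → length xs ≤ n
AllPairs-≢-on⇒length≤ h distinct = injective⇒≤ (lookup-injective distinct)
  where
  lookup-injective : ∀ {xs} → AllPairs (_≢_ on h) xs → ∀ {i j} → h (lookup xs i) ≡ h (lookup xs j) → i ≡ j
  lookup-injective (_ ∷ _)        {zero}  {zero}  _ = ≡.refl
  lookup-injective (h≢ ∷ _)       {zero}  {suc j} e = contradiction e (All.lookup h≢ (∈-lookup j))
  lookup-injective (h≢ ∷ _)       {suc i} {zero}  e = contradiction (≡.sym e) (All.lookup h≢ (∈-lookup i))
  lookup-injective (_ ∷ distinct) {suc i} {suc j} e = ≡.cong suc (lookup-injective distinct e)

Ω : ∀ n → .{{NonZero n}} → ℕ
Ω n = length (factors (factorise n))

HasΩ-Ω : ∀ n .{{_ : NonZero n}} → HasΩ n (Ω n)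
HasΩ-Ω n = factorise n , ≡.refl

HasΩ-unique : ∀ {n i j} → HasΩ n i → HasΩ n j → i ≡ j
HasΩ-unique (f , ∣f∣≡i) (g , ∣g∣≡j) =
  ≡.trans (≡.sym ∣f∣≡i) (≡.trans (↭-length (factorisationUnique f g)) ∣g∣≡j)

HasΩ-* : ∀ {m n i j} → HasΩ m i → HasΩ n j → HasΩ (m * n) (i + j)
HasΩ-* {i = i} {j} (f , ∣f∣≡i) (g , ∣g∣≡j) = fg , (begin
    length (factors f ++ factors g)           ≡⟨ length-++ (factors f) ⟩
    length (factors f) + length (factors g)   ≡⟨ ≡.cong₂ _+_ ∣f∣≡i ∣g∣≡j ⟩
    i + j                                     ∎)
  where
  open ≡.≡-Reasoning
  fg : PrimeFactorisation _
  fg = record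
    { factors         = factors f ++ factors g
    ; isFactorisation = ≡.trans (≡.cong₂ _*_ (isFactorisation f) (isFactorisation g))
                                (≡.sym (product-++ (factors f) (factors g)))
    ; factorsPrime    = All.++⁺ (factorsPrime f) (factorsPrime g)
    }

HasΩ-positive : ∀ {n k} → 1 < n → HasΩ n k → 0 < k
HasΩ-positive 1<n (record { factors = [] ; isFactorisation = ≡.refl } , _) = contradiction 1<n (<-irrefl ≡.refl)
HasΩ-positive 1<n (record { factors = _ ∷ _ } , ≡.refl) = s≤s z≤n

HasΩ-∣-< : ∀ {m n i j} .{{_ : NonZero n}} → m ∣ n → m ≢ n → HasΩ m i → HasΩ n j → i < j
HasΩ-∣-< {m} {n} {i} {j} m∣n m≢n Ωm Ωn = ≡.subst (i <_) k+i≡j (m<n+m i (HasΩ-positive 1<q Ωq))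
  where
  q = quotient m∣n
  instance
    q≢0 : NonZero q
    q≢0 = quotient≢0 m∣n
  1<q : 1 < q
  1<q = quotient>1 m∣n (≤∧≢⇒< (∣⇒≤ m∣n) m≢n)
  k = Ω q
  Ωq : HasΩ q k
  Ωq = HasΩ-Ω q
  k+i≡j : k + i ≡ j
  k+i≡j = HasΩ-unique
    (≡.subst (λ n → HasΩ n (k + i)) (≡.sym (m∣n⇒n≡quotient*m m∣n)) (HasΩ-* Ωq Ωm)) Ωn

prime>1 : ∀ {p} → Prime p → 1 < p
prime>1 {p} p-prime = nonTrivial⇒n>1 p {{prime⇒nonTrivial p-prime}}

length-scanl : ∀ {a b} {A : Set a} {B : Set b} (f : A → B → A) e xs →
               length (scanl f e xs) ≡ suc (length xs)
length-scanl f e []       = ≡.refl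
length-scanl f e (x ∷ xs) = ≡.cong suc (length-scanl f (f e x) xs)

scanl-*-∣ : ∀ d ps → All (_∣ d * product ps) (scanl _*_ d ps)
scanl-*-∣ d []       = m∣m*n 1 ∷ []
scanl-*-∣ d (p ∷ ps) = m∣m*n (p * product ps) ∷
  ≡.subst (λ n → All (_∣ n) (scanl _*_ (d * p) ps)) (*-assoc d p (product ps)) (scanl-*-∣ (d * p) ps)

-- Matching on 1 < p exposes p = 2 + _, so instance search finds NonZero p.
scanl-*-multiples : ∀ d {ps} → All (1 <_) ps → All (λ b → d ∣ b × d ≤ b) (scanl _*_ d ps)
scanl-*-multiples d []                           = (∣-refl , ≤-refl) ∷ []
scanl-*-multiples d {p ∷ ps} (s≤s (s≤s z≤n) ∷ 1<ps) =
  (∣-refl , ≤-refl) ∷ All.map (λ (dp∣b , dp≤b) → ∣-trans (m∣m*n p) dp∣b , ≤-trans (m≤m*n d p) dp≤b)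
                              (scanl-*-multiples (d * p) 1<ps)

scanl-*-strictChain : ∀ d .{{_ : NonZero d}} {ps} → All (1 <_) ps →
                      AllPairs (λ a b → a ∣ b × a < b) (scanl _*_ d ps)
scanl-*-strictChain d []                                  = [] ∷ []
scanl-*-strictChain d {p ∷ ps} (1<p@(s≤s (s≤s z≤n)) ∷ 1<ps) =
  All.map (λ (dp∣b , dp≤b) → ∣-trans (m∣m*n p) dp∣b , <-≤-trans (m<m*n d p 1<p) dp≤b)
          (scanl-*-multiples (d * p) 1<ps)
  ∷ scanl-*-strictChain (d * p) {{m*n≢0 d p}} 1<ps

module Powers {c ℓ : Level} (G : Group c ℓ) where
  open Group G
  open import Algebra.Properties.Group G
  open import Relation.Binary.Reasoning.Setoid setoid

  infixr 8 _^_
  _^_ : Carrier → ℕ → Carrier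
  _^_ = _^ℕ_ G

  ^-congˡ : ∀ {x y} n → x ≈ y → x ^ n ≈ y ^ n
  ^-congˡ zero    x≈y = refl
  ^-congˡ (suc n) x≈y = ∙-cong x≈y (^-congˡ n x≈y)

  ^-congʳ : ∀ x {m n} → m ≡ n → x ^ m ≈ x ^ n
  ^-congʳ x m≡n = reflexive (≡.cong (x ^_) m≡n)

  ^-identityʳ : ∀ x → x ^ 1 ≈ x
  ^-identityʳ = identityʳ

  ε^n≈ε : ∀ n → ε ^ n ≈ ε
  ε^n≈ε zero    = refl
  ε^n≈ε (suc n) = trans (identityˡ _) (ε^n≈ε n)

  ^-homo-+ : ∀ x m n → x ^ (m + n) ≈ x ^ m ∙ x ^ n
  ^-homo-+ x zero    n = sym (identityˡ _)
  ^-homo-+ x (suc m) n = begin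
    x ∙ x ^ (m + n)       ≈⟨ ∙-congˡ (^-homo-+ x m n) ⟩
    x ∙ (x ^ m ∙ x ^ n)   ≈⟨ assoc _ _ _ ⟨
    (x ∙ x ^ m) ∙ x ^ n   ∎

  ^-*-assoc : ∀ x m n → x ^ (m * n) ≈ (x ^ m) ^ n
  ^-*-assoc x m zero    = ^-congʳ x (*-zeroʳ m)
  ^-*-assoc x m (suc n) = begin
    x ^ (m * suc n)          ≈⟨ ^-congʳ x (*-suc m n) ⟩
    x ^ (m + m * n)          ≈⟨ ^-homo-+ x m (m * n) ⟩
    x ^ m ∙ x ^ (m * n)      ≈⟨ ∙-congˡ (^-*-assoc x m n) ⟩
    x ^ m ∙ (x ^ m) ^ n      ∎

  HasOrder-resp-≈ : ∀ {x y n} → x ≈ y → HasOrder G x n → HasOrder G y n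
  HasOrder-resp-≈ {n = n} x≈y (0<n , x^n≈ε , minimal) =
    0<n , trans (^-congˡ n (sym x≈y)) x^n≈ε ,
    λ k 0<k k<n y^k≈ε → minimal k 0<k k<n (trans (^-congˡ k x≈y) y^k≈ε)

  ∈⟨⟩-refl : ∀ x → _∈⟨_⟩ G x x
  ∈⟨⟩-refl x = + 1 , ^-identityʳ x

  ∈⟨⟩-respʳ : ∀ {y y′ z} → y ≈ y′ → _∈⟨_⟩ G z y → _∈⟨_⟩ G z y′
  ∈⟨⟩-respʳ y≈y′ (+ k , y^k≈z)       = + k , trans (^-congˡ k (sym y≈y′)) y^k≈z
  ∈⟨⟩-respʳ y≈y′ (-[1+ k ] , y⁻ᵏ≈z) = -[1+ k ] , trans (⁻¹-cong (^-congˡ (suc k) (sym y≈y′))) y⁻ᵏ≈z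

  ⁻¹-^-∈⟨⟩ : ∀ y n {z} → (y ^ n) ⁻¹ ≈ z → _∈⟨_⟩ G z y
  ⁻¹-^-∈⟨⟩ y zero    ε⁻¹≈z = + 0 , trans (sym ε⁻¹≈ε) ε⁻¹≈z
  ⁻¹-^-∈⟨⟩ y (suc k) y⁻ᵏ≈z = -[1+ k ] , y⁻ᵏ≈z

  module Order {x : Carrier} {N : ℕ} (x-order : HasOrder G x N) where
    private instance
      N≢0 : NonZero N
      N≢0 = >-nonZero (proj₁ x-order)

    x^N≈ε : x ^ N ≈ ε
    x^N≈ε = proj₁ (proj₂ x-order)

    ∣⇒^≈ε : ∀ {a} → N ∣ a → x ^ a ≈ ε
    ∣⇒^≈ε (divides q ≡.refl) = begin
      x ^ (q * N)  ≈⟨ ^-congʳ x (*-comm q N) ⟩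
      x ^ (N * q)  ≈⟨ ^-*-assoc x N q ⟩
      (x ^ N) ^ q  ≈⟨ ^-congˡ q x^N≈ε ⟩
      ε ^ q        ≈⟨ ε^n≈ε q ⟩
      ε            ∎

    ^≈^-mod : ∀ a → x ^ a ≈ x ^ (a % N)
    ^≈^-mod a = begin
      x ^ a                          ≈⟨ ^-congʳ x (m≡m%n+[m/n]*n a N) ⟩
      x ^ (a % N + a / N * N)        ≈⟨ ^-homo-+ x (a % N) (a / N * N) ⟩
      x ^ (a % N) ∙ x ^ (a / N * N)  ≈⟨ ∙-congˡ (∣⇒^≈ε (n∣m*n (a / N))) ⟩
      x ^ (a % N) ∙ ε                ≈⟨ identityʳ _ ⟩
      x ^ (a % N)                    ∎

    ^≈ε⇒∣ : ∀ {a} → x ^ a ≈ ε → N ∣ a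
    ^≈ε⇒∣ {a} x^a≈ε with a % N in a%N≡r
    ... | zero  = m%n≡0⇒n∣m a N a%N≡r
    ... | suc r = contradiction x^[1+r]≈ε (proj₂ (proj₂ x-order) (suc r) (s≤s z≤n) r<N)
      where
      r<N : suc r < N
      r<N = ≡.subst (_< N) a%N≡r (m%n<n a N)
      x^[1+r]≈ε : x ^ suc r ≈ ε
      x^[1+r]≈ε = begin
        x ^ suc r    ≈⟨ ^-congʳ x a%N≡r ⟨
        x ^ (a % N)  ≈⟨ ^≈^-mod a ⟨
        x ^ a        ≈⟨ x^a≈ε ⟩
        ε            ∎

    ^-inverse : ∀ n → (x ^ n) ⁻¹ ≈ x ^ (N * n ∸ n)
    ^-inverse n = sym (inverseʳ-unique (x ^ n) _ (begin
      x ^ n ∙ x ^ (N * n ∸ n)  ≈⟨ ^-homo-+ x n (N * n ∸ n) ⟨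
      x ^ (n + (N * n ∸ n))    ≈⟨ ^-congʳ x (m+[n∸m]≡n (m≤n*m n N)) ⟩
      x ^ (N * n)              ≈⟨ ∣⇒^≈ε (m∣m*n n) ⟩
      ε                        ∎))

    ∈⟨⟩⇒^ : ∀ {z} → _∈⟨_⟩ G z x → ∃ λ j → x ^ j ≈ z
    ∈⟨⟩⇒^ (+ j , x^j≈z)       = j , x^j≈z
    ∈⟨⟩⇒^ (-[1+ k ] , x⁻ᵏ≈z) = N * suc k ∸ suc k , trans (sym (^-inverse (suc k))) x⁻ᵏ≈z

    ^≈^⇒∣ : ∀ {a b d} → x ^ a ≈ x ^ b → d ∣ N → d ∣ b → d ∣ a
    ^≈^⇒∣ {a} {b} {d} x^a≈x^b d∣N d∣b = ∣m+n∣m⇒∣n d∣t+a d∣t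
      where
      t = N * a ∸ a
      x^[b+t]≈ε : x ^ (b + t) ≈ ε
      x^[b+t]≈ε = begin
        x ^ (b + t)          ≈⟨ ^-homo-+ x b t ⟩
        x ^ b ∙ x ^ t        ≈⟨ ∙-congˡ (^-inverse a) ⟨
        x ^ b ∙ (x ^ a) ⁻¹   ≈⟨ x≈y⇒x∙y⁻¹≈ε (sym x^a≈x^b) ⟩
        ε                    ∎
      d∣t : d ∣ t
      d∣t = ∣m+n∣m⇒∣n (∣-trans d∣N (^≈ε⇒∣ x^[b+t]≈ε)) d∣b
      d∣t+a : d ∣ t + a
      d∣t+a = ≡.subst (d ∣_) (≡.sym (m∸n+n≡m (m≤n*m a N))) (∣m⇒∣m*n a d∣N)

    Coprime⇒∈⟨^⟩ : ∀ {j} → Coprime j N → _∈⟨_⟩ G x (x ^ j)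
    Coprime⇒∈⟨^⟩ {j} j⊥N with coprime-Bézout j⊥N
    ... | Bézout.+- u v 1+vN≡uj = + u , (begin
      (x ^ j) ^ u          ≈⟨ ^-*-assoc x j u ⟨
      x ^ (j * u)          ≈⟨ ^-congʳ x (≡.trans (*-comm j u) (≡.sym 1+vN≡uj)) ⟩
      x ^ (1 + v * N)      ≈⟨ ^-homo-+ x 1 (v * N) ⟩
      x ^ 1 ∙ x ^ (v * N)  ≈⟨ ∙-cong (^-identityʳ x) (∣⇒^≈ε (n∣m*n v)) ⟩
      x ∙ ε                ≈⟨ identityʳ x ⟩
      x                    ∎)
    ... | Bézout.-+ u v 1+uj≡vN = ⁻¹-^-∈⟨⟩ (x ^ j) u (sym (inverseˡ-unique x _ (begin
      x ∙ (x ^ j) ^ u      ≈⟨ ∙-cong (^-identityʳ x) (^-*-assoc x j u) ⟨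
      x ^ 1 ∙ x ^ (j * u)  ≈⟨ ^-homo-+ x 1 (j * u) ⟨
      x ^ (1 + j * u)      ≈⟨ ^-congʳ x (≡.trans (≡.cong suc (*-comm j u)) 1+uj≡vN) ⟩
      x ^ (v * N)          ≈⟨ ∣⇒^≈ε (n∣m*n v) ⟩
      ε                    ∎)))

  open Order using (x^N≈ε; ^≈ε⇒∣)

  HasOrder-unique : ∀ {x m n} → HasOrder G x m → HasOrder G x n → m ≡ n
  HasOrder-unique x-order₁ x-order₂ =
    ∣-antisym (^≈ε⇒∣ x-order₁ (x^N≈ε x-order₂)) (^≈ε⇒∣ x-order₂ (x^N≈ε x-order₁))

  HasOrder-^⇒Coprime : ∀ {x j N} → HasOrder G x N → HasOrder G (x ^ j) N → Coprime j N
  HasOrder-^⇒Coprime {x} {j} {N} x-order x^j-order {d} (d∣j , divides c N≡c*d) =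
    *-cancelˡ-≡ d 1 N {{>-nonZero (proj₁ x-order)}}
      (≡.trans (≡.cong (_* d) (≡.sym c≡N)) (≡.trans (≡.sym N≡c*d) (≡.sym (*-identityʳ N))))
    where
    N∣j*c : N ∣ j * c
    N∣j*c = ≡.subst₂ _∣_ (≡.sym N≡c*d) (*-comm c j) (*-monoʳ-∣ c d∣j)
    c≡N : c ≡ N
    c≡N = ∣-antisym
      (divides d (≡.trans N≡c*d (*-comm c d)))
      (^≈ε⇒∣ x^j-order (trans (sym (^-*-assoc x j c)) (Order.∣⇒^≈ε x-order N∣j*c)))

module FiniteGroup {c ℓ : Level} (G : Group c ℓ) {n : ℕ} (enum : Inverse (≡.setoid (Fin n)) (Group.setoid G)) where
  open Group G
  open Powers G
  open import Algebra.Properties.Group G using (identityˡ-unique)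
  open import Relation.Binary.Reasoning.Setoid setoid
  open Inverse enum using (to; from; strictlyInverseˡ)

  index : Injection setoid (≡.setoid (Fin n))
  index = Inverse⇒Injection (Symmetry.inverse enum)

  open Injection index using () renaming (injective to from-injective)

  _≈?_ : Decidable _≈_
  _≈?_ = via-injection index Fin._≟_

  periodic : ∀ x → ∃ λ d → x ^ suc d ≈ ε
  periodic x with pigeonhole (n<1+n n) (λ i → from (x ^ toℕ i))
  ... | i , j , i<j , same-image = d , identityˡ-unique _ (x ^ toℕ i) (begin
    x ^ suc d ∙ x ^ toℕ i  ≈⟨ ^-homo-+ x (suc d) (toℕ i) ⟨
    x ^ (suc d + toℕ i)    ≈⟨ ^-congʳ x (≡.trans (≡.sym (+-suc d (toℕ i))) (m∸n+n≡m i<j)) ⟩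
    x ^ toℕ j              ≈⟨ from-injective same-image ⟨
    x ^ toℕ i              ∎)
    where
    d = toℕ j ∸ suc (toℕ i)

  order : ∀ x → ∃ λ m → HasOrder G x (suc m)
  order x with periodic x
  ... | d , x^[1+d]≈ε with least-witness (λ k → (x ^ suc k) ≈? ε) {d} x^[1+d]≈ε
  ... | m , x^[1+m]≈ε , below-m = m , s≤s z≤n , x^[1+m]≈ε , minimal
    where
    minimal : ∀ k → 0 < k → k < suc m → ¬ (x ^ k ≈ ε)
    minimal (suc k) _ (s≤s k<m) = below-m k k<m

  ord : Carrier → ℕ
  ord x = suc (proj₁ (order x))

  ord-HasOrder : ∀ x → HasOrder G x (ord x)
  ord-HasOrder x = proj₂ (order x)

  ∈⟨⟩⇒^ : ∀ {y z} → _∈⟨_⟩ G z y → ∃ λ j → y ^ j ≈ z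
  ∈⟨⟩⇒^ {y} = Order.∈⟨⟩⇒^ (ord-HasOrder y)

  ∈⟨⟩⇒⊆⟨⟩ : ∀ {x y} → _∈⟨_⟩ G x y → _⊆⟨⟩_ G x y
  ∈⟨⟩⇒⊆⟨⟩ {x} {y} x∈⟨y⟩ z z∈⟨x⟩ with ∈⟨⟩⇒^ x∈⟨y⟩ | ∈⟨⟩⇒^ z∈⟨x⟩
  ... | j , y^j≈x | t , x^t≈z = + (j * t) , (begin
    y ^ (j * t)  ≈⟨ ^-*-assoc y j t ⟩
    (y ^ j) ^ t  ≈⟨ ^-congˡ t y^j≈x ⟩
    x ^ t        ≈⟨ x^t≈z ⟩
    z            ∎)

  ⊆⟨⟩⇒ord∣ : ∀ {x y} → _⊆⟨⟩_ G x y → ord x ∣ ord y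
  ⊆⟨⟩⇒ord∣ {x} {y} x⊆y with ∈⟨⟩⇒^ (x⊆y x (∈⟨⟩-refl x))
  ... | j , y^j≈x = Order.^≈ε⇒∣ (ord-HasOrder x) (begin
    x ^ ord y            ≈⟨ ^-congˡ (ord y) y^j≈x ⟨
    (y ^ j) ^ ord y      ≈⟨ ^-*-assoc y j (ord y) ⟨
    y ^ (j * ord y)      ≈⟨ Order.∣⇒^≈ε (ord-HasOrder y) (n∣m*n j) ⟩
    ε                    ∎)

  ⊊⟨⟩⇒ord≢ : ∀ {x y} → _⊊⟨⟩_ G x y → ord x ≢ ord y
  ⊊⟨⟩⇒ord≢ {x} {y} (x⊆y , y⊈x) ordx≡ordy with ∈⟨⟩⇒^ (x⊆y x (∈⟨⟩-refl x))
  ... | j , y^j≈x = y⊈x (∈⟨⟩⇒⊆⟨⟩ (∈⟨⟩-respʳ y^j≈x (Order.Coprime⇒∈⟨^⟩ (ord-HasOrder y) j⊥ord-y)))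
    where
    j⊥ord-y : Coprime j (ord y)
    j⊥ord-y = HasOrder-^⇒Coprime (ord-HasOrder y)
                (HasOrder-resp-≈ (sym y^j≈x) (≡.subst (HasOrder G x) ordx≡ordy (ord-HasOrder x)))

  Ω∘ord : Carrier → ℕ
  Ω∘ord x = Ω (ord x)

  HasOrder∧HasΩ⇒≡Ω∘ord : ∀ {x m k} → HasOrder G x m → HasΩ m k → k ≡ Ω∘ord x
  HasOrder∧HasΩ⇒≡Ω∘ord {x} x-order Ωm =
    HasΩ-unique (≡.subst (λ m → HasΩ m _) (HasOrder-unique x-order (ord-HasOrder x)) Ωm) (HasΩ-Ω (ord x))

  ⊊⟨⟩⇒Ω∘ord< : ∀ {x y} → _⊊⟨⟩_ G x y → Ω∘ord x < Ω∘ord y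
  ⊊⟨⟩⇒Ω∘ord< x⊊y = HasΩ-∣-< (⊆⟨⟩⇒ord∣ (proj₁ x⊊y)) (⊊⟨⟩⇒ord≢ x⊊y) (HasΩ-Ω _) (HasΩ-Ω _)

  Adj⇒Ω∘ord≢ : ∀ {x y} → Adj G x y → Ω∘ord x ≢ Ω∘ord y
  Adj⇒Ω∘ord≢ (_ , inj₁ x⊊y) = <⇒≢ (⊊⟨⟩⇒Ω∘ord< x⊊y)
  Adj⇒Ω∘ord≢ (_ , inj₂ y⊊x) = ≡.≢-sym (<⇒≢ (⊊⟨⟩⇒Ω∘ord< y⊊x))

  maximiser : Carrier
  maximiser = argmax Ω∘ord ε (map to (allFin n))

  Ω∘ord≤max : ∀ x → Ω∘ord x ≤ Ω∘ord maximiser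
  Ω∘ord≤max x = ≤-trans (≤-reflexive Ω∘ord[x]≡)
    (All.lookup (f[xs]≤f[argmax] {f = Ω∘ord} ε (map to (allFin n))) (∈-map⁺ to (∈-allFin (from x))))
    where
    Ω∘ord[x]≡ : Ω∘ord x ≡ Ω∘ord (to (from x))
    Ω∘ord[x]≡ = HasOrder∧HasΩ⇒≡Ω∘ord (HasOrder-resp-≈ (sym (strictlyInverseˡ x)) (ord-HasOrder x))
                                     (HasΩ-Ω (ord x))

  clique-length≤ : ∀ {ys} → IsClique G ys → length ys ≤ suc (Ω∘ord maximiser)
  clique-length≤ clique = AllPairs-≢-on⇒length≤ level (AllPairs.map distinct-levels clique)
    where
    level : Carrier → Fin (suc (Ω∘ord maximiser))
    level x = fromℕ< (s≤s (Ω∘ord≤max x))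
    distinct-levels : ∀ {x y} → Adj G x y → level x ≢ level y
    distinct-levels adj = Adj⇒Ω∘ord≢ adj ∘ fromℕ<-injective _ _ _ _

  ^-adjacent : ∀ {x N a b} → HasOrder G x N → a ∣ b → a < b → b ∣ N → Adj G (x ^ a) (x ^ b)
  ^-adjacent {x} {a = a} {b} x-order a∣b@(divides q b≡q*a) a<b b∣N =
    x^a≉x^b , inj₂ (∈⟨⟩⇒⊆⟨⟩ x^b∈⟨x^a⟩ , λ x^a⊆x^b → x^a∉⟨x^b⟩ (x^a⊆x^b (x ^ a) (∈⟨⟩-refl (x ^ a))))
    where
    x^b∈⟨x^a⟩ : _∈⟨_⟩ G (x ^ b) (x ^ a)
    x^b∈⟨x^a⟩ = + q , (begin
      (x ^ a) ^ q  ≈⟨ ^-*-assoc x a q ⟨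
      x ^ (a * q)  ≈⟨ ^-congʳ x (≡.trans (*-comm a q) (≡.sym b≡q*a)) ⟩
      x ^ b        ∎)
    x^a∉⟨x^b⟩ : ¬ _∈⟨_⟩ G (x ^ a) (x ^ b)
    x^a∉⟨x^b⟩ x^a∈⟨x^b⟩ with ∈⟨⟩⇒^ x^a∈⟨x^b⟩
    ... | k , [x^b]^k≈x^a = <⇒≢ a<b (∣-antisym a∣b b∣a)
      where
      b∣a : b ∣ a
      b∣a = Order.^≈^⇒∣ x-order (sym (trans (^-*-assoc x b k) [x^b]^k≈x^a)) b∣N (m∣m*n k)
    x^a≉x^b : ¬ (x ^ a ≈ x ^ b)
    x^a≉x^b x^a≈x^b = x^a∉⟨x^b⟩ (+ 1 , trans (^-identityʳ (x ^ b)) (sym x^a≈x^b))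

  ^-clique : ∀ {x N es} → HasOrder G x N → AllPairs (λ a b → a ∣ b × a < b) es → All (_∣ N) es →
             IsClique G (map (x ^_) es)
  ^-clique x-order []              []          = []
  ^-clique x-order (a≺es ∷ chain) (_ ∷ es∣N) =
    All.map⁺ (All.zipWith (λ ((a∣b , a<b) , b∣N) → ^-adjacent x-order a∣b a<b b∣N) (a≺es , es∣N))
    ∷ ^-clique x-order chain es∣N

  HasOrder∧HasΩ⇒clique : ∀ {x N k} → HasOrder G x N → HasΩ N k → CliqueSize G (suc k)
  HasOrder∧HasΩ⇒clique {x} {N} x-order (f , ∣f∣≡k) =
    map (x ^_) exponents ,
    ^-clique x-order (scanl-*-strictChain 1 (All.map prime>1 (factorsPrime f))) exponents∣N ,
    ≡.trans (length-map (x ^_) exponents) (≡.trans (length-scanl _*_ 1 (factors f)) (≡.cong suc ∣f∣≡k))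
    where
    exponents = scanl _*_ 1 (factors f)
    exponents∣N : All (_∣ N) exponents
    exponents∣N = ≡.subst (λ m → All (_∣ m) exponents)
                    (≡.trans (*-identityˡ _) (≡.sym (isFactorisation f))) (scanl-*-∣ 1 (factors f))

lemma5p4 : ∀ {c ℓ : Level} (G : Group c ℓ) → IsFinite G →
    Σ ℕ λ M → IsMax (ΩOfElementOrder G) M × CliqueNumber G (suc M)
lemma5p4 G (n , enum) = M , (M-attained , M-bound) , (HasOrder∧HasΩ⇒clique x-order Ω[ord-x] , clique-bound)
  where
  open FiniteGroup G enum
  x = maximiser
  M = Ω∘ord x
  x-order : HasOrder G x (ord x)
  x-order = ord-HasOrder x
  Ω[ord-x] : HasΩ (ord x) M
  Ω[ord-x] = HasΩ-Ω (ord x)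

  M-attained : ΩOfElementOrder G M
  M-attained = x , ord x , x-order , Ω[ord-x]

  M-bound : ∀ k → ΩOfElementOrder G k → k ≤ M
  M-bound k (y , m , y-order , Ωm) = ≤-trans (≤-reflexive (HasOrder∧HasΩ⇒≡Ω∘ord y-order Ωm)) (Ω∘ord≤max y)

  clique-bound : ∀ k → CliqueSize G k → k ≤ suc M
  clique-bound k (ys , clique , ∣ys∣≡k) = ≡.subst (_≤ suc M) ∣ys∣≡k (clique-length≤ clique)
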